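{- Let $k\in\mathbb{Z}$ and $n,d\in\mathbb{Z}^+$ with $n$ even. Let $v_0$ be the root of $T_{2,d}$, let $v_1,v_1'$ be the two children of $v_0$, and let $T$ and $T'$ be the rooted perfect binary subtrees of height $d-1$ with roots $v_1$ and $v_1'$ respectively. Suppose $T_{2,d}$ admits a closed coloring with remainder $k\bmod n$ that is constant on each level of $T$ and constant on each level of $T'$. Then $T_{2,d}$ admits a closed coloring with remainder $k\bmod n$ that is constant on every level of $T_{2,d}$.
   Context: $T_{2,d}$ is the rooted perfect binary tree of height $d$: the root is at level $0$, every vertex at level $i<d$ has exactly two children at level $i+1$, and level $d$ consists of leaves. A closed coloring with remainder $k\bmod n$ of a graph $G=(V,E)$ is a map $\ell:V\to\mathbb{Z}$ with $\sum_{w\in N[v]}\ell(w)\equiv k\pmod n$ for every $v\in V$, where $N[v]$ is the closed neighborhood of $v$. -}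

module Defs where

open import Data.Bool using (Bool; true; false; if_then_else_)
open import Data.List using (List; []; _∷_; length; _∷ʳ_)
open import Data.Nat as ℕ using (ℕ; _<ᵇ_)
open import Data.Integer using (ℤ; +_; _+_; _-_)
open import Data.Integer.Divisibility using (_∣_)
open import Relation.Binary.PropositionalEquality using (_≡_)

-- Vertices of T_{2,d}: paths from the root, i.e. lists of directions
-- (false = left child, true = right child) of length ≤ d.
-- The root is [], the level of a vertex is its length,
-- the children of p are p ∷ʳ false and p ∷ʳ true, the parent of a
-- nonempty p is p with its last entry removed.

Vertex : Set
Vertex = List Bool

dropLast : List Bool → List Bool
dropLast []           = []
dropLast (x ∷ [])     = []
dropLast (x ∷ y ∷ p)  = x ∷ dropLast (y ∷ p)

parentTerm : (Vertex → ℤ) → Vertex → ℤ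
parentTerm ℓ []      = + 0
parentTerm ℓ (x ∷ p) = ℓ (dropLast (x ∷ p))

childTerm : ℕ → (Vertex → ℤ) → Vertex → ℤ
childTerm d ℓ p =
  if length p <ᵇ d then ℓ (p ∷ʳ false) + ℓ (p ∷ʳ true) else + 0

closedSum : ℕ → (Vertex → ℤ) → Vertex → ℤ
closedSum d ℓ p = ℓ p + parentTerm ℓ p + childTerm d ℓ p

-- ℓ is a closed coloring of T_{2,d} with remainder k mod n.
-- (ℓ is given on all lists; only its values on vertices, length ≤ d, matter.)
IsClosedColoring : ℕ → ℕ → ℤ → (Vertex → ℤ) → Set
IsClosedColoring d n k ℓ =
  ∀ (p : Vertex) → length p ℕ.≤ d → (+ n) ∣ (closedSum d ℓ p - k)

LevelConstant : ℕ → (Vertex → ℤ) → Set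
LevelConstant d ℓ =
  ∀ (p q : Vertex) → length p ≡ length q → length p ℕ.≤ d → ℓ p ≡ ℓ q

SubtreeLevelConstant : ℕ → Bool → (Vertex → ℤ) → Set
SubtreeLevelConstant d b ℓ =
  ∀ (p q : Vertex) → length p ≡ length q → length p ℕ.< d → ℓ (b ∷ p) ≡ ℓ (b ∷ q)

-- Along each of the two subtrees, the closed-neighbourhood equations read from the leaves upwards
-- determine every level value from the leaf value: at height h it is congruent to profile k α h,
-- which is affine in the leaf value α with an odd coefficient c_h. If α and β are the leaf values
-- of the two subtrees, the root gets both profile values, so (α − β) c_d ≡ 0 (mod n). Writing
-- c_d = 2w + 1, the leaf value t = α − (α − β)(w + 1) satisfies 2t = α + β − (α − β) c_d, hence it
-- reproduces both the root value and the sum of the root's two children. The coloring that is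
-- constant on levels with leaf value t thus satisfies the root equation, and it satisfies every
-- other equation exactly.
module Submission where

open import Data.Bool using (Bool; true; false)
open import Data.Bool.Properties using (if-cong; T-≡)
open import Data.Integer using (ℤ; +_; _+_; _-_; _*_; -_)
import Data.Integer.Properties as ℤ
open import Data.Integer.Divisibility.Signed
  using (_∣_; divides; ∣ᵤ⇒∣; ∣⇒∣ᵤ; ∣m∣n⇒∣m+n; ∣m∣n⇒∣m-n; ∣m⇒∣-m; ∣n⇒∣m*n)
open import Data.Integer.Tactic.RingSolver using (solve-∀)
open import Data.List using (List; []; _∷_; length; _∷ʳ_; replicate)
open import Data.List.Properties using (length-++; length-replicate)
open import Data.Nat as ℕ using (ℕ; zero; suc; _≥_; _<_; _≤_; _<ᵇ_; _∸_; z≤n; z<s)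
open import Data.Nat.Properties
  using (+-comm; +-suc; +-identityʳ; m+n∸m≡n; m<m+n; <⇒<ᵇ; <⇒≤; ≤-reflexive; m≤n⇒∃[o]m+o≡n)
open import Data.Product using (Σ; ∃; _×_; _,_; proj₁; proj₂)
open import Function.Base using (_∘′_)
open import Function.Bundles using (Equivalence)
open import Level using (0ℓ)
open import Relation.Binary.Bundles using (Setoid)
open import Relation.Binary.Structures using (IsEquivalence)
import Relation.Binary.Reasoning.Setoid as SetoidReasoning
open import Relation.Binary.PropositionalEquality
open import Defs

-- The value at height h of a level-constant closed coloring with remainder k and leaf value t.
profile : ℤ → ℤ → ℕ → ℤ
profile k t zero = t
profile k t (suc zero) = k - t
profile k t (suc (suc h)) = k - profile k t (suc h) - + 2 * profile k t h

profile-leaf : ∀ k t → profile k t 0 + profile k t 1 ≡ k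
profile-leaf = identity
  where
  identity : ∀ k t → t + (k - t) ≡ k
  identity = solve-∀

profile-step : ∀ k t h →
  profile k t (suc h) + profile k t (suc (suc h)) + (profile k t h + profile k t h) ≡ k
profile-step k t h = identity k (profile k t (suc h)) (profile k t h)
  where
  identity : ∀ k b a → b + (k - b - + 2 * a) + (a + a) ≡ k
  identity = solve-∀

profile-affine : ∀ k t h → profile k t h ≡ profile k (+ 0) h + t * profile (+ 0) (+ 1) h
profile-affine k t zero = identity t
  where
  identity : ∀ t → t ≡ + 0 + t * + 1
  identity = solve-∀
profile-affine k t (suc zero) = identity k t
  where
  identity : ∀ k t → k - t ≡ (k - + 0) + t * (+ 0 - + 1)
  identity = solve-∀
profile-affine k t (suc (suc h)) =
  trans (cong₂ (λ x y → k - x - + 2 * y) (profile-affine k t (suc h)) (profile-affine k t h))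
        (identity k t (profile k (+ 0) (suc h)) (profile (+ 0) (+ 1) (suc h))
                      (profile k (+ 0) h) (profile (+ 0) (+ 1) h))
  where
  identity : ∀ k t a₁ c₁ a₀ c₀ →
    k - (a₁ + t * c₁) - + 2 * (a₀ + t * c₀) ≡ (k - a₁ - + 2 * a₀) + t * (+ 0 - c₁ - + 2 * c₀)
  identity = solve-∀

profile-unit-odd : ∀ h → ∃ λ w → profile (+ 0) (+ 1) h ≡ + 2 * w + + 1
profile-unit-odd zero = + 0 , refl
profile-unit-odd (suc zero) = - + 1 , refl
profile-unit-odd (suc (suc h)) with profile-unit-odd (suc h) | profile-unit-odd h
... | w₁ , odd₁ | w₀ , odd₀ =
  - w₁ - + 2 * w₀ - + 2 ,
  trans (cong₂ (λ x y → + 0 - x - + 2 * y) odd₁ odd₀) (identity w₁ w₀)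
  where
  identity : ∀ w₁ w₀ →
    + 0 - (+ 2 * w₁ + + 1) - + 2 * (+ 2 * w₀ + + 1) ≡ + 2 * (- w₁ - + 2 * w₀ - + 2) + + 1
  identity = solve-∀

profile-shift : ∀ k α β w h →
  profile k (α - (α - β) * w) h ≡ profile k α h - w * (profile k α h - profile k β h)
profile-shift k α β w h
  rewrite profile-affine k (α - (α - β) * w) h | profile-affine k α h | profile-affine k β h
  = identity (profile k (+ 0) h) (profile (+ 0) (+ 1) h) α β w
  where
  identity : ∀ p c α β w → p + (α - (α - β) * w) * c ≡ p + α * c - w * (p + α * c - (p + β * c))
  identity = solve-∀

profile-twice-midpoint : ∀ k α β w h → profile (+ 0) (+ 1) (suc h) ≡ + 2 * w + + 1 →
  let t = α - (α - β) * (w + + 1) in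
  profile k t h + profile k t h
    ≡ profile k α h + profile k β h
      - profile (+ 0) (+ 1) h * (profile k α (suc h) - profile k β (suc h))
profile-twice-midpoint k α β w h odd
  rewrite profile-affine k (α - (α - β) * (w + + 1)) h | profile-affine k α h | profile-affine k β h
        | profile-affine k α (suc h) | profile-affine k β (suc h) | odd
  = identity (profile k (+ 0) h) (profile (+ 0) (+ 1) h) (profile k (+ 0) (suc h)) α β w
  where
  identity : ∀ p c p₁ α β w → let t = α - (α - β) * (w + + 1) in
    p + t * c + (p + t * c)
      ≡ p + α * c + (p + β * c) - c * (p₁ + α * (+ 2 * w + + 1) - (p₁ + β * (+ 2 * w + + 1)))
  identity = solve-∀

module Congruence (m : ℤ) where

  infix 4 _≈_

  -- A record rather than m ∣ x - y itself, so that x and y can be inferred from x ≈ y.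
  record _≈_ (x y : ℤ) : Set where
    constructor congruent
    field m∣x-y : m ∣ x - y

  open _≈_ public

  private
    congruent-by : ∀ {x y z} → z ≡ x - y → m ∣ z → x ≈ y
    congruent-by refl = congruent

  ≈-reflexive : ∀ {x y} → x ≡ y → x ≈ y
  ≈-reflexive {x} refl = congruent-by (identity x m) (divides (+ 0) refl)
    where
    identity : ∀ x m → + 0 * m ≡ x - x
    identity = solve-∀

  ≈-sym : ∀ {x y} → x ≈ y → y ≈ x
  ≈-sym {x} {y} (congruent x∣y) = congruent-by (identity x y) (∣m⇒∣-m x∣y)
    where
    identity : ∀ x y → - (x - y) ≡ y - x
    identity = solve-∀

  ≈-trans : ∀ {x y z} → x ≈ y → y ≈ z → x ≈ z
  ≈-trans {x} {y} {z} (congruent x∣y) (congruent y∣z) =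
    congruent-by (identity x y z) (∣m∣n⇒∣m+n x∣y y∣z)
    where
    identity : ∀ x y z → (x - y) + (y - z) ≡ x - z
    identity = solve-∀

  ≈-refl : ∀ {x} → x ≈ x
  ≈-refl = ≈-reflexive refl

  ≈-isEquivalence : IsEquivalence _≈_
  ≈-isEquivalence = record { refl = ≈-refl ; sym = ≈-sym ; trans = ≈-trans }

  ≈-setoid : Setoid 0ℓ 0ℓ
  ≈-setoid = record { isEquivalence = ≈-isEquivalence }

  module ≈-Reasoning = SetoidReasoning ≈-setoid

  +-cong : ∀ {a b c d} → a ≈ b → c ≈ d → a + c ≈ b + d
  +-cong {a} {b} {c} {d} (congruent a∣b) (congruent c∣d) =
    congruent-by (identity a b c d) (∣m∣n⇒∣m+n a∣b c∣d)
    where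
    identity : ∀ a b c d → (a - b) + (c - d) ≡ (a + c) - (b + d)
    identity = solve-∀

  minus-cong : ∀ {a b c d} → a ≈ b → c ≈ d → a - c ≈ b - d
  minus-cong {a} {b} {c} {d} (congruent a∣b) (congruent c∣d) =
    congruent-by (identity a b c d) (∣m∣n⇒∣m-n a∣b c∣d)
    where
    identity : ∀ a b c d → (a - b) - (c - d) ≡ (a - c) - (b - d)
    identity = solve-∀

  *-congˡ : ∀ c {a b} → a ≈ b → c * a ≈ c * b
  *-congˡ c {a} {b} (congruent a∣b) = congruent-by (identity c a b) (∣n⇒∣m*n c a∣b)
    where
    identity : ∀ c a b → c * (a - b) ≡ c * a - c * b
    identity = solve-∀

  ≈-by-multiple : ∀ {x y a b} c → a ≈ b → x ≡ y - c * (a - b) → x ≈ y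
  ≈-by-multiple {y = y} {a} {b} c (congruent a∣b) refl =
    congruent-by (identity y c a b) (∣n⇒∣m*n (- c) a∣b)
    where
    identity : ∀ y c a b → - c * (a - b) ≡ y - c * (a - b) - y
    identity = solve-∀

  parent-from-leaf : ∀ {k a b t} → a + b ≈ k → a ≈ t → b ≈ k - t
  parent-from-leaf {k} {a} {b} {t} leaf a≈t = begin
    b           ≡⟨ identity a b ⟩
    a + b - a   ≈⟨ minus-cong leaf a≈t ⟩
    k - t       ∎
    where
    open ≈-Reasoning
    identity : ∀ a b → b ≡ a + b - a
    identity = solve-∀

  parent-from-inner : ∀ {k a b c s₁ s₀} → a + b + (c + c) ≈ k → a ≈ s₁ → c ≈ s₀ →
                      b ≈ k - s₁ - + 2 * s₀
  parent-from-inner {k} {a} {b} {c} {s₁} {s₀} inner a≈s₁ c≈s₀ = begin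
    b                               ≡⟨ identity a b c ⟩
    a + b + (c + c) - a - + 2 * c   ≈⟨ minus-cong (minus-cong inner a≈s₁) (*-congˡ (+ 2) c≈s₀) ⟩
    k - s₁ - + 2 * s₀               ∎
    where
    open ≈-Reasoning
    identity : ∀ a b c → b ≡ a + b + (c + c) - a - + 2 * c
    identity = solve-∀

  -- F i is the value on level i of a tree of height d, which is at height j when i + j ≡ d.
  profile-unique : ∀ k (F : ℕ → ℤ) d →
    (∀ i → suc i ≡ d → F (suc i) + F i ≈ k) →
    (∀ i → suc i < d → F (suc i) + F i + (F (suc (suc i)) + F (suc (suc i))) ≈ k) →
    ∀ i j → i ℕ.+ j ≡ d → F i ≈ profile k (F d) j
  profile-unique k F d leaf inner i zero i+0≡d =
    ≈-reflexive (cong F (trans (sym (+-identityʳ i)) i+0≡d))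
  profile-unique k F d leaf inner i (suc zero) i+1≡d =
    parent-from-leaf (leaf i 1+i≡d) (≈-reflexive (cong F 1+i≡d))
    where
    1+i≡d : suc i ≡ d
    1+i≡d = trans (+-comm 1 i) i+1≡d
  profile-unique k F d leaf inner i (suc (suc j)) i+2+j≡d =
    parent-from-inner (inner i 1+i<d)
      (profile-unique k F d leaf inner (suc i) (suc j) 1+i+1+j≡d)
      (profile-unique k F d leaf inner (suc (suc i)) j (trans (sym (+-suc (suc i) j)) 1+i+1+j≡d))
    where
    1+i+1+j≡d : suc i ℕ.+ suc j ≡ d
    1+i+1+j≡d = trans (sym (+-suc i (suc j))) i+2+j≡d
    1+i<d : suc i < d
    1+i<d = subst (suc i <_) 1+i+1+j≡d (m<m+n (suc i) z<s)

  profile-midpoint : ∀ k α β h → profile k α (suc h) ≈ profile k β (suc h) →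
    ∃ λ t → profile k t (suc h) ≈ profile k α (suc h)
          × profile k t h + profile k t h ≈ profile k α h + profile k β h
  profile-midpoint k α β h agree with profile-unit-odd (suc h)
  ... | w , odd =
    α - (α - β) * (w + + 1) ,
    ≈-by-multiple (w + + 1) agree (profile-shift k α β (w + + 1) (suc h)) ,
    ≈-by-multiple (profile (+ 0) (+ 1) h) agree (profile-twice-midpoint k α β w h odd)

length-∷ʳ : ∀ {A : Set} (p : List A) x → length (p ∷ʳ x) ≡ suc (length p)
length-∷ʳ p x = trans (length-++ p) (+-comm (length p) 1)

replicate-∷ʳ : ∀ {A : Set} i (x : A) → replicate i x ∷ʳ x ≡ replicate (suc i) x
replicate-∷ʳ zero x = refl
replicate-∷ʳ (suc i) x = cong (x ∷_) (replicate-∷ʳ i x)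

dropLast-∷ʳ : ∀ (p : Vertex) b → dropLast (p ∷ʳ b) ≡ p
dropLast-∷ʳ [] b = refl
dropLast-∷ʳ (x ∷ []) b = refl
dropLast-∷ʳ (x ∷ y ∷ p) b = cong (x ∷_) (dropLast-∷ʳ (y ∷ p) b)

length-dropLast : ∀ x (p : Vertex) → length (dropLast (x ∷ p)) ≡ length p
length-dropLast x [] = refl
length-dropLast x (y ∷ p) = cong suc (length-dropLast y p)

<ᵇ-irrefl : ∀ n → (n <ᵇ n) ≡ false
<ᵇ-irrefl zero = refl
<ᵇ-irrefl (suc n) = <ᵇ-irrefl n

childTerm-inner : ∀ {d} ℓ (p : Vertex) → length p < d →
                  childTerm d ℓ p ≡ ℓ (p ∷ʳ false) + ℓ (p ∷ʳ true)
childTerm-inner ℓ p p<d = if-cong (Equivalence.to T-≡ (<⇒<ᵇ p<d))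

childTerm-leaf : ∀ {d} ℓ (p : Vertex) → length p ≡ d → childTerm d ℓ p ≡ + 0
childTerm-leaf ℓ p refl = if-cong (<ᵇ-irrefl (length p))

-- The leftmost vertex on level i of the subtree rooted at [ b ] (the root when i = 0).
branch : Bool → ℕ → Vertex
branch b zero = []
branch b (suc i) = b ∷ replicate i false

length-branch : ∀ b i → length (branch b i) ≡ i
length-branch b zero = refl
length-branch b (suc i) = cong suc (length-replicate i)

parentTerm-branch : ∀ ℓ b i → parentTerm ℓ (branch b (suc i)) ≡ ℓ (branch b i)
parentTerm-branch ℓ b zero = refl
parentTerm-branch ℓ b (suc i) =
  cong ℓ (trans (cong (λ r → dropLast (b ∷ r)) (sym (replicate-∷ʳ i false)))
                (dropLast-∷ʳ (branch b (suc i)) false))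

childTerm-branch : ∀ {d} ℓ b i → SubtreeLevelConstant d b ℓ → suc i < d →
  childTerm d ℓ (branch b (suc i)) ≡ ℓ (branch b (suc (suc i))) + ℓ (branch b (suc (suc i)))
childTerm-branch {d} ℓ b i constant 1+i<d =
  trans (childTerm-inner ℓ (branch b (suc i)) (subst (_< d) (sym (length-branch b (suc i))) 1+i<d))
        (cong₂ _+_ (cong (λ r → ℓ (b ∷ r)) (replicate-∷ʳ i false)) sibling)
  where
  sibling : ℓ (b ∷ (replicate i false ∷ʳ true)) ≡ ℓ (branch b (suc (suc i)))
  sibling = constant (replicate i false ∷ʳ true) (replicate (suc i) false)
    (length-∷ʳ (replicate i false) true)
    (subst (_< d) (sym (trans (length-∷ʳ (replicate i false) true) (cong suc (length-replicate i))))
           1+i<d)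

closedSum-branch-inner : ∀ {d} ℓ b i → SubtreeLevelConstant d b ℓ → suc i < d →
  closedSum d ℓ (branch b (suc i))
    ≡ ℓ (branch b (suc i)) + ℓ (branch b i)
      + (ℓ (branch b (suc (suc i))) + ℓ (branch b (suc (suc i))))
closedSum-branch-inner ℓ b i constant 1+i<d =
  cong₂ (λ x y → ℓ (branch b (suc i)) + x + y)
        (parentTerm-branch ℓ b i) (childTerm-branch ℓ b i constant 1+i<d)

closedSum-branch-leaf : ∀ {d} ℓ b i → suc i ≡ d →
  closedSum d ℓ (branch b (suc i)) ≡ ℓ (branch b (suc i)) + ℓ (branch b i)
closedSum-branch-leaf ℓ b i 1+i≡d =
  trans (cong₂ (λ x y → ℓ (branch b (suc i)) + x + y) (parentTerm-branch ℓ b i)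
               (childTerm-leaf ℓ (branch b (suc i)) (trans (length-branch b (suc i)) 1+i≡d)))
        (ℤ.+-identityʳ _)

module _ {k : ℤ} {n d : ℕ} (ℓ : Vertex → ℤ) (coloring : IsClosedColoring d n k ℓ) where
  open Congruence (+ n)

  closedSum≈ : ∀ p → length p ≤ d → closedSum d ℓ p ≈ k
  closedSum≈ p p≤d = congruent (∣ᵤ⇒∣ (coloring p p≤d))

  branch-profile : ∀ b → SubtreeLevelConstant d b ℓ →
                   ∀ i j → i ℕ.+ j ≡ d → ℓ (branch b i) ≈ profile k (ℓ (branch b d)) j
  branch-profile b constant = profile-unique k (ℓ ∘′ branch b) d leaf inner
    where
    vertex≈ : ∀ i → suc i ≤ d → closedSum d ℓ (branch b (suc i)) ≈ k
    vertex≈ i 1+i≤d =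
      closedSum≈ (branch b (suc i)) (subst (_≤ d) (sym (length-branch b (suc i))) 1+i≤d)
    leaf : ∀ i → suc i ≡ d → ℓ (branch b (suc i)) + ℓ (branch b i) ≈ k
    leaf i 1+i≡d = ≈-trans (≈-reflexive (sym (closedSum-branch-leaf ℓ b i 1+i≡d)))
                           (vertex≈ i (≤-reflexive 1+i≡d))
    inner : ∀ i → suc i < d →
      ℓ (branch b (suc i)) + ℓ (branch b i)
        + (ℓ (branch b (suc (suc i))) + ℓ (branch b (suc (suc i)))) ≈ k
    inner i 1+i<d = ≈-trans (≈-reflexive (sym (closedSum-branch-inner ℓ b i constant 1+i<d)))
                            (vertex≈ i (<⇒≤ 1+i<d))

heightColoring : ℤ → ℤ → ℕ → Vertex → ℤ
heightColoring k t d p = profile k t (d ∸ length p)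

∸-height : ∀ L h {d} → L ℕ.+ h ≡ d → d ∸ L ≡ h
∸-height L h refl = m+n∸m≡n L h

closedSum-heightColoring : ∀ k t {d} x (q : Vertex) h → suc (length q) ℕ.+ h ≡ d →
  closedSum d (heightColoring k t d) (x ∷ q)
    ≡ profile k t h + profile k t (suc h) + childTerm d (heightColoring k t d) (x ∷ q)
closedSum-heightColoring k t {d} x q h 1+q+h≡d =
  cong₂ (λ a b → profile k t a + profile k t b + childTerm d (heightColoring k t d) (x ∷ q))
        (∸-height (suc (length q)) h 1+q+h≡d)
        (trans (cong (d ∸_) (length-dropLast x q))
               (∸-height (length q) (suc h) (trans (+-suc (length q) h) 1+q+h≡d)))

heightColoring-nonroot : ∀ k t {d} x (q : Vertex) → suc (length q) ≤ d →
                         closedSum d (heightColoring k t d) (x ∷ q) ≡ k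
heightColoring-nonroot k t {d} x q 1+q≤d with m≤n⇒∃[o]m+o≡n 1+q≤d
... | zero , 1+q+0≡d = begin
  closedSum d ℓ (x ∷ q)               ≡⟨ closedSum-heightColoring k t x q 0 1+q+0≡d ⟩
  s 0 + s 1 + childTerm d ℓ (x ∷ q)   ≡⟨ cong (_+_ (s 0 + s 1)) no-children ⟩
  s 0 + s 1 + + 0                     ≡⟨ ℤ.+-identityʳ _ ⟩
  s 0 + s 1                           ≡⟨ profile-leaf k t ⟩
  k                                   ∎
  where
  open ≡-Reasoning
  ℓ : Vertex → ℤ
  ℓ = heightColoring k t d
  s : ℕ → ℤ
  s = profile k t
  no-children : childTerm d ℓ (x ∷ q) ≡ + 0
  no-children = childTerm-leaf ℓ (x ∷ q) (trans (sym (+-identityʳ (suc (length q)))) 1+q+0≡d)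
... | suc h , 1+q+1+h≡d = begin
  closedSum d ℓ (x ∷ q)
    ≡⟨ closedSum-heightColoring k t x q (suc h) 1+q+1+h≡d ⟩
  s (suc h) + s (suc (suc h)) + childTerm d ℓ (x ∷ q)
    ≡⟨ cong (_+_ (s (suc h) + s (suc (suc h)))) children ⟩
  s (suc h) + s (suc (suc h)) + (s h + s h)
    ≡⟨ profile-step k t h ⟩
  k ∎
  where
  open ≡-Reasoning
  ℓ : Vertex → ℤ
  ℓ = heightColoring k t d
  s : ℕ → ℤ
  s = profile k t
  child : ∀ b → ℓ ((x ∷ q) ∷ʳ b) ≡ s h
  child b = cong s
    (trans (cong (λ L → d ∸ suc L) (length-∷ʳ q b))
           (∸-height (suc (suc (length q))) h
                     (trans (sym (+-suc (suc (length q)) h)) 1+q+1+h≡d)))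
  children : childTerm d ℓ (x ∷ q) ≡ s h + s h
  children =
    trans (childTerm-inner ℓ (x ∷ q) (subst (suc (length q) <_) 1+q+1+h≡d (m<m+n _ z<s)))
          (cong₂ _+_ (child false) (child true))

heightColoring-levelConstant : ∀ k t d → LevelConstant d (heightColoring k t d)
heightColoring-levelConstant k t d p q |p|≡|q| _ = cong (λ L → profile k t (d ∸ L)) |p|≡|q|

heightColoring-from-branches : ∀ {k n d} ℓ → IsClosedColoring (suc d) n k ℓ →
  SubtreeLevelConstant (suc d) false ℓ → SubtreeLevelConstant (suc d) true ℓ →
  ∃ λ t → IsClosedColoring (suc d) n k (heightColoring k t (suc d))
heightColoring-from-branches {k} {n} {d} ℓ coloring constant₀ constant₁ = t , coloring′
  where
  open Congruence (+ n)
  α β : ℤ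
  α = ℓ (branch false (suc d))
  β = ℓ (branch true (suc d))
  profile₀ : ∀ i j → i ℕ.+ j ≡ suc d → ℓ (branch false i) ≈ profile k α j
  profile₀ = branch-profile ℓ coloring false constant₀
  profile₁ : ∀ i j → i ℕ.+ j ≡ suc d → ℓ (branch true i) ≈ profile k β j
  profile₁ = branch-profile ℓ coloring true constant₁
  midpoint : ∃ λ t → profile k t (suc d) ≈ profile k α (suc d)
                   × profile k t d + profile k t d ≈ profile k α d + profile k β d
  midpoint = profile-midpoint k α β d
    (≈-trans (≈-sym (profile₀ 0 (suc d) refl)) (profile₁ 0 (suc d) refl))
  t : ℤ
  t = proj₁ midpoint
  root : closedSum (suc d) (heightColoring k t (suc d)) [] ≈ k
  root = begin
    profile k t (suc d) + + 0 + (profile k t d + profile k t d)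
      ≈⟨ +-cong (+-cong (proj₁ (proj₂ midpoint)) ≈-refl) (proj₂ (proj₂ midpoint)) ⟩
    profile k α (suc d) + + 0 + (profile k α d + profile k β d)
      ≈⟨ ≈-sym (+-cong (+-cong (profile₀ 0 (suc d) refl) ≈-refl)
                       (+-cong (profile₀ 1 d refl) (profile₁ 1 d refl))) ⟩
    closedSum (suc d) ℓ []
      ≈⟨ closedSum≈ ℓ coloring [] z≤n ⟩
    k ∎
    where open ≈-Reasoning
  coloring′ : IsClosedColoring (suc d) n k (heightColoring k t (suc d))
  coloring′ [] _ = ∣⇒∣ᵤ (m∣x-y root)
  coloring′ (x ∷ q) 1+q≤1+d = ∣⇒∣ᵤ (m∣x-y (≈-reflexive (heightColoring-nonroot k t x q 1+q≤1+d)))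

lemma6p3 : (k : ℤ) (n d : ℕ) → n ≥ 1 → d ≥ 1 → Σ ℕ (λ m → n ≡ 2 ℕ.* m) →
    Σ (Vertex → ℤ) (λ ℓ → IsClosedColoring d n k ℓ
                          × SubtreeLevelConstant d false ℓ
                          × SubtreeLevelConstant d true ℓ) →
    Σ (Vertex → ℤ) (λ ℓ → IsClosedColoring d n k ℓ × LevelConstant d ℓ)
lemma6p3 k n zero _ () _ _
lemma6p3 k n (suc d) _ _ _ (ℓ , coloring , constant₀ , constant₁)
  with heightColoring-from-branches ℓ coloring constant₀ constant₁
... | t , coloring′ =
  heightColoring k t (suc d) , coloring′ , heightColoring-levelConstant k t (suc d)
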